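{- Let $G$ be a tree-path intersection graph with the rooting and orders described in the context. The relation $<_b$ is a (strict) partial order on $G_H\cup G_V$ that extends $<$.
   Context: A tree-path intersection graph is a connected bipartite graph $G$ with disjoint parts $G_H$, $G_V$, together with a tree $T_H$ on vertex set $G_H$ and a tree $T_V$ on vertex set $G_V$, such that for every $h\in G_H$ the neighbourhood $\Gamma(h)$ of $h$ in $G$ is the vertex set of a path in $T_V$, and for every $v\in G_V$ the neighbourhood $\Gamma(v)$ is the vertex set of a path in $T_H$. Fix an edge $h_{\mathrm{root}}v_{\mathrm{root}}\in E(G)$ such that $v_{\mathrm{root}}$ is a leaf of $T_V$; root $T_H$ at $h_{\mathrm{root}}$ and $T_V$ at $v_{\mathrm{root}}$. For $s_1,s_2$ both in $G_H$ (resp. both in $G_V$), $s_1\le s_2$ iff $s_1$ lies on the path of $T_H$ (resp. $T_V$) from the root to $s_2$; vertices from different sides are incomparable; $<$ is the strict version. $\min\Gamma(s)$ denotes the unique $\le$-minimal element of $\Gamma(s)$ (it exists since $\Gamma(s)$ is a path in a rooted tree). The relation $<_b$ is defined as follows: for $h_1,h_2\in G_H$, $h_1<_b h_2$ iff $\min\Gamma(h_1)<\min\Gamma(h_2)$, or $\min\Gamma(h_1)=\min\Gamma(h_2)$ and $h_1<h_2$; analogously for $v_1,v_2\in G_V$; elements of $G_H$ and $G_V$ are not $<_b$-comparable. -}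

module Defs where

open import Data.Nat using (ℕ)
open import Data.Fin using (Fin)
open import Data.List using (List; []; _∷_; [_])
open import Data.List.Membership.Propositional using (_∈_)
open import Data.List.Relation.Unary.Unique.Propositional using (Unique)
open import Data.Sum using (_⊎_; inj₁; inj₂)
open import Data.Product using (Σ; ∃; ∃-syntax; _×_; _,_)
open import Data.Empty using (⊥)
open import Relation.Nullary using (¬_)
open import Relation.Binary.PropositionalEquality using (_≡_; _≢_)
open import Function.Bundles using (_⇔_)

data WalkFT {A : Set} (R : A → A → Set) : A → A → List A → Set where
  single : ∀ {x} → WalkFT R x x [ x ]
  step   : ∀ {x y z p} → R x y → WalkFT R y z p → WalkFT R x z (x ∷ p)

PathFT : {A : Set} → (A → A → Set) → A → A → List A → Set
PathFT R x y p = WalkFT R x y p × Unique p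

IsPath : {A : Set} → (A → A → Set) → List A → Set
IsPath {A} R p = ∃[ x ] ∃[ y ] PathFT R x y p

IsSimpleGraph : {A : Set} → (A → A → Set) → Set
IsSimpleGraph {A} R = (∀ x y → R x y → R y x) × (∀ x → ¬ R x x)

Connected : {A : Set} → (A → A → Set) → Set
Connected {A} R = ∀ x y → ∃[ p ] WalkFT R x y p

IsTree : {A : Set} → (A → A → Set) → Set
IsTree {A} R = IsSimpleGraph R ×
  (∀ x y → ∃[ p ] PathFT R x y p) ×
  (∀ x y p q → PathFT R x y p → PathFT R x y q → p ≡ q)

IsLeaf : {A : Set} → (A → A → Set) → A → Set
IsLeaf R v = ∀ x y → R v x → R v y → x ≡ y

-- Bipartite graph with parts Fin nH (G_H) and Fin nV (G_V),
-- edges given by E : G_H → G_V → Set.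

Vert : ℕ → ℕ → Set
Vert nH nV = Fin nH ⊎ Fin nV

GAdj : ∀ {nH nV} → (Fin nH → Fin nV → Set) → Vert nH nV → Vert nH nV → Set
GAdj E (inj₁ h) (inj₁ h') = ⊥
GAdj E (inj₁ h) (inj₂ v)  = E h v
GAdj E (inj₂ v) (inj₁ h)  = E h v
GAdj E (inj₂ v) (inj₂ v') = ⊥

record IsTreePathIntersectionGraph {nH nV : ℕ}
    (E : Fin nH → Fin nV → Set)
    (TH : Fin nH → Fin nH → Set) (TV : Fin nV → Fin nV → Set) : Set where
  field
    connected : Connected (GAdj E)
    treeH     : IsTree TH
    treeV     : IsTree TV
    nbhdH     : ∀ h → ∃[ p ] (IsPath TV p × (∀ v → (v ∈ p) ⇔ E h v))
    nbhdV     : ∀ v → ∃[ p ] (IsPath TH p × (∀ h → (h ∈ p) ⇔ E h v))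

module Orders {nH nV : ℕ}
    (E : Fin nH → Fin nV → Set)
    (TH : Fin nH → Fin nH → Set) (TV : Fin nV → Fin nV → Set)
    (hroot : Fin nH) (vroot : Fin nV) where

  TreeLe : {A : Set} → (A → A → Set) → A → A → A → Set
  TreeLe R r s₁ s₂ = ∃[ p ] (PathFT R r s₂ p × s₁ ∈ p)

  _≤_ : Vert nH nV → Vert nH nV → Set
  inj₁ h₁ ≤ inj₁ h₂ = TreeLe TH hroot h₁ h₂
  inj₁ h₁ ≤ inj₂ v₂ = ⊥
  inj₂ v₁ ≤ inj₁ h₂ = ⊥
  inj₂ v₁ ≤ inj₂ v₂ = TreeLe TV vroot v₁ v₂

  _<_ : Vert nH nV → Vert nH nV → Set
  s₁ < s₂ = (s₁ ≤ s₂) × (s₁ ≢ s₂)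

  Γ : Vert nH nV → Vert nH nV → Set
  Γ s t = GAdj E s t

  IsMinΓ : Vert nH nV → Vert nH nV → Set
  IsMinΓ s m = Γ s m × (∀ t → Γ s t → m ≤ t)

  _<b_ : Vert nH nV → Vert nH nV → Set
  inj₁ h₁ <b inj₁ h₂ = ∃[ m₁ ] ∃[ m₂ ]
    (IsMinΓ (inj₁ h₁) m₁ × IsMinΓ (inj₁ h₂) m₂ ×
     ((m₁ < m₂) ⊎ ((m₁ ≡ m₂) × (inj₁ h₁ < inj₁ h₂))))
  inj₁ h₁ <b inj₂ v₂ = ⊥
  inj₂ v₁ <b inj₁ h₂ = ⊥
  inj₂ v₁ <b inj₂ v₂ = ∃[ m₁ ] ∃[ m₂ ]
    (IsMinΓ (inj₂ v₁) m₁ × IsMinΓ (inj₂ v₂) m₂ ×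
     ((m₁ < m₂) ⊎ ((m₁ ≡ m₂) × (inj₂ v₁ < inj₂ v₂))))

{-# OPTIONS --safe #-}
-- Since Γ(s) is a path in a rooted tree it has a ≤-least vertex min Γ(s), and comparing
-- minima first and vertices second is a strict order. It extends < because min Γ is
-- monotone along T_H (and symmetrically along T_V). For a parent p of c, connectivity of
-- G gives a common neighbour of p and c; so if min Γ(p) ≰ min Γ(c), the path Γ(c) leaves
-- the subtree of min Γ(p) through its parent w. Then Γ(w), which contains c but not p,
-- lies in the subtree of c, whereas Γ(v_root) ∋ h_root does not. Where this changes along
-- the T_V-path from v_root to w, the two adjacent vertices share a neighbour, which puts
-- p into the neighbourhood of a vertex ≤ w, contradicting the minimality of min Γ(p).
module Submission where

open import Defs
open import Data.Empty using (⊥-elim)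
open import Data.Fin using (Fin; _≟_)
open import Data.List using (List; []; _∷_; [_]; _++_; _∷ʳ_; map)
open import Data.List.Membership.Propositional using (_∈_; _∉_; find; lose)
open import Data.List.Membership.Propositional.Properties
  using (∈-∃++; ∈-++⁺ˡ; ∈-++⁺ʳ; ∈-++⁻)
open import Data.List.Properties
  using ( ∷-injective; ++-assoc; ∷ʳ-injectiveˡ; ∷ʳ-injectiveʳ
        ; ++-identityʳ; ++-identityʳ-unique; ++-conicalˡ )
open import Data.List.Relation.Unary.All as All using (All)
import Data.List.Relation.Unary.All.Properties as AllP
open import Data.List.Relation.Unary.AllPairs using ([]; _∷_)
open import Data.List.Relation.Unary.Any as Any using (Any; here; there)
open import Data.List.Relation.Unary.Any.Properties using (singleton⁻)
open import Data.List.Relation.Unary.Unique.Propositional using (Unique)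
import Data.List.Relation.Unary.Unique.Propositional.Properties as Unique
open import Data.Nat using (ℕ)
open import Data.Product using (∃; ∃₂; ∃-syntax; _×_; _,_; proj₁; proj₂)
open import Data.Sum using (_⊎_; inj₁; inj₂; swap)
open import Data.Sum.Properties using (≡-dec; swap-involutive)
open import Function using (_∘_; flip)
open import Function.Bundles using (_⇔_; Equivalence)
open import Relation.Binary.Construct.Closure.ReflexiveTransitive as Star using (Star; ε; _◅_)
open import Relation.Binary.Definitions using (DecidableEquality)
open import Relation.Binary.PropositionalEquality
  using (_≡_; _≢_; refl; sym; trans; cong; subst; subst₂; isEquivalence; module ≡-Reasoning)
open import Relation.Binary.Structures using (IsStrictPartialOrder)
open import Relation.Nullary using (¬_; Dec; yes; no; ¬?)
open import Relation.Nullary.Decidable using (decidable-stable)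
open import Relation.Unary using (Decidable)

module _ {A : Set} {R : A → A → Set} where

  walk-head∈ : ∀ {x y l} → WalkFT R x y l → x ∈ l
  walk-head∈ single     = here refl
  walk-head∈ (step _ _) = here refl

  walk-∷ʳ-last : ∀ {x y l} → WalkFT R x y l → ∃ λ xs → l ≡ xs ∷ʳ y
  walk-∷ʳ-last single = [] , refl
  walk-∷ʳ-last {x} (step _ w) with xs , eq ← walk-∷ʳ-last w = x ∷ xs , cong (x ∷_) eq

  walk-last∈ : ∀ {x y l} → WalkFT R x y l → y ∈ l
  walk-last∈ w with xs , refl ← walk-∷ʳ-last w = ∈-++⁺ʳ xs (here refl)

  -- xs is split twice so that the coverage checker can rule out 'single' for xs ≢ [].
  walk-prefix : ∀ xs {a ys x z} → WalkFT R x z (xs ++ a ∷ ys) → WalkFT R x a (xs ∷ʳ a)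
  walk-prefix []           single     = single
  walk-prefix []           (step _ _) = single
  walk-prefix (_ ∷ [])     (step r w) = step r (walk-prefix [] w)
  walk-prefix (_ ∷ x ∷ xs) (step r w) = step r (walk-prefix (x ∷ xs) w)

  walk-suffix : ∀ xs {a ys x z} → WalkFT R x z (xs ++ a ∷ ys) → WalkFT R a z (a ∷ ys)
  walk-suffix []           single     = single
  walk-suffix []           (step r w) = step r w
  walk-suffix (_ ∷ [])     (step _ w) = walk-suffix [] w
  walk-suffix (_ ∷ x ∷ xs) (step _ w) = walk-suffix (x ∷ xs) w

  walk-∷ʳ : ∀ {x y z l} → WalkFT R x y l → R y z → WalkFT R x z (l ∷ʳ z)
  walk-∷ʳ single      r = step r single
  walk-∷ʳ (step r′ w) r = step r′ (walk-∷ʳ w r)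

  record Crossing (Q : A → Set) (l : List A) : Set where
    constructor crossing
    field
      {inner outer} : A
      inner∈  : inner ∈ l
      outer∈  : outer ∈ l
      edge    : R inner outer
      inside  : Q inner
      outside : ¬ Q outer

  walk-crossing : ∀ {Q x y l b} → Decidable Q → WalkFT R x y l →
                  Q x → b ∈ l → ¬ Q b → Crossing Q l
  walk-crossing Q? single      qx (here refl) ¬qb = ⊥-elim (¬qb qx)
  walk-crossing Q? (step _ _)  qx (here refl) ¬qb = ⊥-elim (¬qb qx)
  walk-crossing Q? (step {y = y} r w) qx (there b∈) ¬qb with Q? y
  ... | no ¬qy = crossing (here refl) (there (walk-head∈ w)) r qx ¬qy
  ... | yes qy with crossing i∈ o∈ e qi ¬qo ← walk-crossing Q? w qy b∈ ¬qb =
    crossing (there i∈) (there o∈) e qi ¬qo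

  walk-crossing-sym : ∀ {Q x y l a b} → (∀ u v → R u v → R v u) → Decidable Q →
                      WalkFT R x y l → a ∈ l → Q a → b ∈ l → ¬ Q b → Crossing Q l
  walk-crossing-sym {x = x} R-sym Q? w a∈ qa b∈ ¬qb with Q? x
  ... | yes qx = walk-crossing Q? w qx b∈ ¬qb
  ... | no ¬qx
    with crossing i∈ o∈ e ¬qi ¬¬qo ← walk-crossing (¬? ∘ Q?) w ¬qx a∈ (λ ¬qa → ¬qa qa) =
    crossing o∈ i∈ (R-sym _ _ e) (decidable-stable (Q? _) ¬¬qo) ¬qi

module _ {A B : Set} {R : A → A → Set} {S : B → B → Set} (f : A → B) where

  walk-map : (∀ x y → R x y → S (f x) (f y)) →
             ∀ {x y l} → WalkFT R x y l → WalkFT S (f x) (f y) (map f l)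
  walk-map f-hom single     = single
  walk-map f-hom (step r w) = step (f-hom _ _ r) (walk-map f-hom w)

module _ {A : Set} where

  Unique-++⁻ˡ : ∀ (xs : List A) {ys} → Unique (xs ++ ys) → Unique xs
  Unique-++⁻ˡ []       _        = []
  Unique-++⁻ˡ (x ∷ xs) (x∉ ∷ u) = AllP.++⁻ˡ xs x∉ ∷ Unique-++⁻ˡ xs u

  Unique-++⁻ʳ : ∀ (xs : List A) {ys} → Unique (xs ++ ys) → Unique ys
  Unique-++⁻ʳ []       u       = u
  Unique-++⁻ʳ (_ ∷ xs) (_ ∷ u) = Unique-++⁻ʳ xs u

  ++-prefixes-comparable : ∀ (xs ys xs′ ys′ : List A) → xs ++ xs′ ≡ ys ++ ys′ →
                           (∃ λ zs → ys ≡ xs ++ zs) ⊎ (∃ λ zs → xs ≡ ys ++ zs)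
  ++-prefixes-comparable []       ys       _   _   _  = inj₁ (ys , refl)
  ++-prefixes-comparable (x ∷ xs) []       _   _   _  = inj₂ (x ∷ xs , refl)
  ++-prefixes-comparable (x ∷ xs) (y ∷ ys) xs′ ys′ eq with refl , eq′ ← ∷-injective eq
    with ++-prefixes-comparable xs ys xs′ ys′ eq′
  ... | inj₁ (zs , e) = inj₁ (zs , cong (x ∷_) e)
  ... | inj₂ (zs , e) = inj₂ (zs , cong (x ∷_) e)

  module _ {R : A → A → Set} where

    path-prefix : ∀ xs {a ys x z} → PathFT R x z (xs ++ a ∷ ys) → PathFT R x a (xs ∷ʳ a)
    path-prefix xs {a} {ys} (w , u) =
      walk-prefix xs w , Unique-++⁻ˡ (xs ∷ʳ a) (subst Unique (sym (++-assoc xs [ a ] ys)) u)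

    path-suffix : ∀ xs {a ys x z} → PathFT R x z (xs ++ a ∷ ys) → PathFT R a z (a ∷ ys)
    path-suffix xs (w , u) = walk-suffix xs w , Unique-++⁻ʳ xs u

    path-∷ʳ : ∀ {x y z l} → PathFT R x y l → R y z → z ∉ l → PathFT R x z (l ∷ʳ z)
    path-∷ʳ (w , u) r z∉ =
      walk-∷ʳ w r , Unique.++⁺ u (All.[] ∷ []) λ { (z∈ , here refl) → z∉ z∈ ; (_ , there ()) }

module RootedTree {A : Set} (_≟ₐ_ : DecidableEquality A)
    {R : A → A → Set} (tree : IsTree R) (root : A) where
  open import Data.List.Membership.DecPropositional _≟ₐ_ using (_∈?_)
  open ≡-Reasoning

  R-sym : ∀ x y → R x y → R y x
  R-sym = proj₁ (proj₁ tree)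

  private
    R-irrefl : ∀ x → ¬ R x x
    R-irrefl = proj₂ (proj₁ tree)

    paths-unique : ∀ {x y p q} → PathFT R x y p → PathFT R x y q → p ≡ q
    paths-unique = proj₂ (proj₂ tree) _ _ _ _

  rootPath : A → List A
  rootPath x = proj₁ (proj₁ (proj₂ tree) root x)

  rootPath-path : ∀ x → PathFT R root x (rootPath x)
  rootPath-path x = proj₂ (proj₁ (proj₂ tree) root x)

  rootPath-canonical : ∀ {x l} → PathFT R root x l → rootPath x ≡ l
  rootPath-canonical = paths-unique (rootPath-path _)

  rootPath-root : rootPath root ≡ [ root ]
  rootPath-root = rootPath-canonical (single , All.[] ∷ [])

  rootPath-injective : ∀ {x y} → rootPath x ≡ rootPath y → x ≡ y
  rootPath-injective {x} {y} eq
    with xs , ex ← walk-∷ʳ-last (proj₁ (rootPath-path x))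
       | ys , ey ← walk-∷ʳ-last (proj₁ (rootPath-path y))
    = ∷ʳ-injectiveʳ xs ys (trans (sym ex) (trans eq ey))

  rootPath-split : ∀ {a b} xs {ys} → rootPath b ≡ xs ++ a ∷ ys → rootPath a ≡ xs ∷ʳ a
  rootPath-split {b = b} xs eq =
    rootPath-canonical (path-prefix xs (subst (PathFT R root b) eq (rootPath-path b)))

  infix 4 _≼_
  _≼_ : A → A → Set
  a ≼ b = a ∈ rootPath b

  _≼?_ : ∀ a b → Dec (a ≼ b)
  a ≼? b = a ∈? rootPath b

  ≼-refl : ∀ {a} → a ≼ a
  ≼-refl = walk-last∈ (proj₁ (rootPath-path _))

  ≼⇒rootPath-prefix : ∀ {a b} → a ≼ b → ∃ λ zs → rootPath b ≡ rootPath a ++ zs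
  ≼⇒rootPath-prefix {a} {b} a≼b with xs , zs , eq ← ∈-∃++ a≼b = zs , (begin
    rootPath b         ≡⟨ eq ⟩
    xs ++ a ∷ zs       ≡⟨ ++-assoc xs [ a ] zs ⟨
    (xs ∷ʳ a) ++ zs    ≡⟨ cong (_++ zs) (rootPath-split xs eq) ⟨
    rootPath a ++ zs   ∎)

  ≼-trans : ∀ {a b c} → a ≼ b → b ≼ c → a ≼ c
  ≼-trans a≼b b≼c with zs , eq ← ≼⇒rootPath-prefix b≼c = subst (_ ∈_) (sym eq) (∈-++⁺ˡ a≼b)

  ≼-antisym : ∀ {a b} → a ≼ b → b ≼ a → a ≡ b
  ≼-antisym {a} {b} a≼b b≼a
    with ys , eb ← ≼⇒rootPath-prefix a≼b | zs , ea ← ≼⇒rootPath-prefix b≼a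
    = rootPath-injective (begin
      rootPath a               ≡⟨ ++-identityʳ (rootPath a) ⟨
      rootPath a ++ []         ≡⟨ cong (rootPath a ++_) (sym ys≡[]) ⟩
      rootPath a ++ ys         ≡⟨ eb ⟨
      rootPath b               ∎)
    where
    ys≡[] : ys ≡ []
    ys≡[] = ++-conicalˡ ys zs (++-identityʳ-unique (rootPath a) (begin
      rootPath a               ≡⟨ ea ⟩
      rootPath b ++ zs         ≡⟨ cong (_++ zs) eb ⟩
      (rootPath a ++ ys) ++ zs ≡⟨ ++-assoc (rootPath a) ys zs ⟩
      rootPath a ++ ys ++ zs   ∎))

  ≼-root : ∀ {a} → a ≼ root → a ≡ root
  ≼-root = singleton⁻ ∘ subst (_ ∈_) rootPath-root

  ≼-comparable : ∀ {a b c} → a ≼ c → b ≼ c → a ≼ b ⊎ b ≼ a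
  ≼-comparable {a} {b} a≼c b≼c
    with xs , ea ← ≼⇒rootPath-prefix a≼c | ys , eb ← ≼⇒rootPath-prefix b≼c
    with ++-prefixes-comparable (rootPath a) (rootPath b) xs ys (trans (sym ea) eb)
  ... | inj₁ (zs , e) = inj₁ (subst (a ∈_) (sym e) (∈-++⁺ˡ ≼-refl))
  ... | inj₂ (zs , e) = inj₂ (subst (b ∈_) (sym e) (∈-++⁺ˡ ≼-refl))

  Parent : A → A → Set
  Parent p c = rootPath c ≡ rootPath p ∷ʳ c

  parent⇒≼ : ∀ {p c} → Parent p c → p ≼ c
  parent⇒≼ e = subst (_ ∈_) (sym e) (∈-++⁺ˡ ≼-refl)

  parent-unique : ∀ {p q c} → Parent p c → Parent q c → p ≡ q
  parent-unique {p} {q} ep eq =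
    rootPath-injective (∷ʳ-injectiveˡ (rootPath p) (rootPath q) (trans (sym ep) eq))

  parent-≢ : ∀ {p c} → Parent p c → p ≢ c
  parent-≢ {p} e refl with () ← ++-identityʳ-unique (rootPath p) e

  parent⇒⋡ : ∀ {p c} → Parent p c → ¬ c ≼ p
  parent⇒⋡ e c≼p = parent-≢ e (≼-antisym (parent⇒≼ e) c≼p)

  parent⇒⋠root : ∀ {p c} → Parent p c → ¬ c ≼ root
  parent⇒⋠root e c≼root with refl ← ≼-root c≼root = parent-≢ e (≼-root (parent⇒≼ e))

  edge⇒parent : ∀ {a b} → R a b → Parent a b ⊎ Parent b a
  edge⇒parent {a} {b} r with b ∈? rootPath a
  ... | no b∉ = inj₁ (rootPath-canonical (path-∷ʳ (rootPath-path a) r b∉))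
  ... | yes b∈ with xs , ys , eq ← ∈-∃++ b∈ = inj₂ (begin
    rootPath a          ≡⟨ eq ⟩
    xs ++ b ∷ ys        ≡⟨ cong (λ zs → xs ++ b ∷ zs) ys≡[a] ⟩
    xs ++ b ∷ [ a ]     ≡⟨ ++-assoc xs [ b ] [ a ] ⟨
    (xs ∷ʳ b) ∷ʳ a      ≡⟨ cong (_∷ʳ a) (rootPath-split xs eq) ⟨
    rootPath b ∷ʳ a     ∎)
    where
    b≢a : b ≢ a
    b≢a refl = R-irrefl a r
    ys≡[a] : ys ≡ [ a ]
    ys≡[a] = proj₂ (∷-injective (paths-unique
      (path-suffix xs (subst (PathFT R root a) eq (rootPath-path a)))
      (step (R-sym _ _ r) single , (b≢a All.∷ All.[]) ∷ All.[] ∷ [])))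

  ≼⇒Parent* : ∀ {a b} → a ≼ b → Star Parent a b
  ≼⇒Parent* a≼b = go _ (proj₂ (≼⇒rootPath-prefix a≼b))
    where
    go : ∀ ys {a b} → rootPath b ≡ rootPath a ++ ys → Star Parent a b
    go []       {a} e with refl ← rootPath-injective (trans e (++-identityʳ (rootPath a))) = ε
    go (y ∷ ys) {a} {b} e = pay ◅ go ys (begin
      rootPath b                 ≡⟨ e ⟩
      rootPath a ++ y ∷ ys       ≡⟨ ++-assoc (rootPath a) [ y ] ys ⟨
      (rootPath a ∷ʳ y) ++ ys    ≡⟨ cong (_++ ys) pay ⟨
      rootPath y ++ ys           ∎)
      where
      pay : Parent a y
      pay = rootPath-split (rootPath a) e

  walk-minimum : ∀ {x y l} → WalkFT R x y l → ∃ λ m → m ∈ l × (∀ {t} → t ∈ l → m ≼ t)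
  walk-minimum {x} single = x , here refl , λ { (here refl) → ≼-refl }
  walk-minimum {x} (step {y = y} r w) with m , m∈ , m≼ ← walk-minimum w with edge⇒parent r
  ... | inj₂ pyx = m , there m∈ , λ { (here refl) → ≼-trans (m≼ (walk-head∈ w)) (parent⇒≼ pyx)
                                    ; (there t∈)  → m≼ t∈ }
  ... | inj₁ pxy with ≼-comparable (m≼ (walk-head∈ w)) (parent⇒≼ pxy)
  ...   | inj₁ m≼x = m , there m∈ , λ { (here refl) → m≼x ; (there t∈) → m≼ t∈ }
  ...   | inj₂ x≼m = x , here refl , λ { (here refl) → ≼-refl
                                       ; (there t∈)  → ≼-trans x≼m (m≼ t∈) }

  walk-enters-subtree : ∀ {x y l a b c} → WalkFT R x y l → a ∈ l → c ≼ a → b ∈ l → ¬ c ≼ b →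
                        ∃ λ p → Parent p c × p ∈ l × c ∈ l
  walk-enters-subtree {c = c} w a∈ c≼a b∈ c⋠b
    with crossing {a′} {b′} a′∈ b′∈ r c≼a′ c⋠b′
           ← walk-crossing-sym R-sym (c ≼?_) w a∈ c≼a b∈ c⋠b
    with edge⇒parent r
  ... | inj₁ pa′b′ = ⊥-elim (c⋠b′ (≼-trans c≼a′ (parent⇒≼ pa′b′)))
  ... | inj₂ pb′a′ with ∈-++⁻ (rootPath b′) (subst (c ∈_) pb′a′ c≼a′)
  ...   | inj₁ c≼b′       = ⊥-elim (c⋠b′ c≼b′)
  ...   | inj₂ (here refl) = b′ , pb′a′ , b′∈ , a′∈

  ≼⇒TreeLe : ∀ {a b} → a ≼ b → ∃[ p ] (PathFT R root b p × a ∈ p)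
  ≼⇒TreeLe a≼b = rootPath _ , rootPath-path _ , a≼b

  TreeLe⇒≼ : ∀ {a b} → ∃[ p ] (PathFT R root b p × a ∈ p) → a ≼ b
  TreeLe⇒≼ (p , path , a∈) = subst (_ ∈_) (sym (rootPath-canonical path)) a∈

module _ {nA nB : ℕ} (E : Fin nA → Fin nB → Set) where

  GAdj-sym : ∀ x y → GAdj E x y → GAdj E y x
  GAdj-sym (inj₁ _) (inj₂ _) e = e
  GAdj-sym (inj₂ _) (inj₁ _) e = e

  GAdj-swap : ∀ x y → GAdj E x y → GAdj (flip E) (swap x) (swap y)
  GAdj-swap (inj₁ _) (inj₂ _) e = e
  GAdj-swap (inj₂ _) (inj₁ _) e = e

  connected-flip : Connected (GAdj E) → Connected (GAdj (flip E))
  connected-flip conn x y with p , w ← conn (swap x) (swap y) =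
    map swap p , subst₂ (λ x′ y′ → WalkFT _ x′ y′ _) (swap-involutive x) (swap-involutive y)
                        (walk-map swap GAdj-swap w)

PathNeighbourhoods : {nA nB : ℕ} → (Fin nA → Fin nB → Set) → (Fin nA → Fin nA → Set) → Set
PathNeighbourhoods {nA} {nB} E T = ∀ (b : Fin nB) → ∃[ p ] (IsPath T p × (∀ a → (a ∈ p) ⇔ E a b))

module NeighbourhoodPaths {nA nB : ℕ} (E : Fin nA → Fin nB → Set) {TA : Fin nA → Fin nA → Set}
    (treeA : IsTree TA) (rA : Fin nA) (N : PathNeighbourhoods E TA) where
  open RootedTree _≟_ treeA rA

  Γ : Fin nB → List (Fin nA)
  Γ b = proj₁ (N b)

  Γ-walk : ∀ b → ∃₂ λ x y → WalkFT TA x y (Γ b)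
  Γ-walk b with x , y , w , _ ← proj₁ (proj₂ (N b)) = x , y , w

  ∈Γ⇒E : ∀ {a b} → a ∈ Γ b → E a b
  ∈Γ⇒E {a} {b} = Equivalence.to (proj₂ (proj₂ (N b)) a)

  E⇒∈Γ : ∀ {a b} → E a b → a ∈ Γ b
  E⇒∈Γ {a} {b} = Equivalence.from (proj₂ (proj₂ (N b)) a)

  Γ-minimum : ∀ b → ∃ λ m → E m b × (∀ {a} → E a b → m ≼ a)
  Γ-minimum b with _ , _ , w ← Γ-walk b with m , m∈ , m≼ ← walk-minimum w =
    m , ∈Γ⇒E m∈ , m≼ ∘ E⇒∈Γ

  Γ-straddle : ∀ {a a′ b c} → c ≼ a → E a b → ¬ c ≼ a′ → E a′ b →
               ∃ λ p → Parent p c × E p b × E c b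
  Γ-straddle c≼a eab c⋠a′ ea′b with _ , _ , w ← Γ-walk _
    with p , pc , p∈ , c∈ ← walk-enters-subtree w (E⇒∈Γ eab) c≼a (E⇒∈Γ ea′b) c⋠a′ =
    p , pc , ∈Γ⇒E p∈ , ∈Γ⇒E c∈

  module _ (conn : Connected (GAdj E)) where

    parent-common-neighbour : ∀ {p c} → Parent p c → ∃ λ b → E p b × E c b
    parent-common-neighbour {p} {c} pc with _ , w ← conn (inj₁ c) (inj₁ p)
      with walk-crossing-sym (GAdj-sym E) below? w (walk-head∈ w) ≼-refl
                                                     (walk-last∈ w) (parent⇒⋡ pc)
      where
      Below : Vert nA nB → Set
      Below (inj₁ a) = c ≼ a
      Below (inj₂ b) = Any (c ≼_) (Γ b)
      below? : Decidable Below
      below? (inj₁ a) = c ≼? a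
      below? (inj₂ b) = Any.any? (c ≼?_) (Γ b)
    ... | crossing {inj₁ _} {inj₂ _} _ _ eab c≼a ¬below =
      ⊥-elim (¬below (lose (E⇒∈Γ eab) c≼a))
    ... | crossing {inj₂ _} {inj₁ _} _ _ eab below c⋠a
      with a₀ , a₀∈ , c≼a₀ ← find below
      with p′ , p′c , ep′b , ecb ← Γ-straddle c≼a₀ (∈Γ⇒E a₀∈) c⋠a eab
      with refl ← parent-unique p′c pc = _ , ep′b , ecb

    edge-common-neighbour : ∀ {x y} → TA x y → ∃ λ b → E x b × E y b
    edge-common-neighbour r with edge⇒parent r
    ... | inj₁ pxy = parent-common-neighbour pxy
    ... | inj₂ pyx with b , eyb , exb ← parent-common-neighbour pyx = b , exb , eyb

module MinNeighbour {nA nB : ℕ} (E : Fin nA → Fin nB → Set)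
    {TA : Fin nA → Fin nA → Set} {TB : Fin nB → Fin nB → Set}
    (treeA : IsTree TA) (treeB : IsTree TB) (rA : Fin nA) (rB : Fin nB) (root-edge : E rA rB)
    (NA : PathNeighbourhoods (flip E) TB) (NB : PathNeighbourhoods E TA)
    (conn : Connected (GAdj E)) where
  private
    module A = RootedTree _≟_ treeA rA
    module B = RootedTree _≟_ treeB rB
    module ΓB = NeighbourhoodPaths E treeA rA NB
    module ΓA = NeighbourhoodPaths (flip E) treeB rB NA

  minΓ : Fin nA → Fin nB
  minΓ a = proj₁ (ΓA.Γ-minimum a)

  minΓ-adjacent : ∀ {a} → E a (minΓ a)
  minΓ-adjacent = proj₁ (proj₂ (ΓA.Γ-minimum _))

  minΓ-least : ∀ {a b} → E a b → minΓ a B.≼ b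
  minΓ-least = proj₂ (proj₂ (ΓA.Γ-minimum _))

  -- Inside holds at w but not at rB, while no-exit-from-Inside forbids it to change along
  -- the T_B-path from rB to w.
  module _ {p c w} (pc : A.Parent p c) (wm : B.Parent w (minΓ p)) where
    private
      Inside : Fin nB → Set
      Inside b = All (c A.≼_) (ΓB.Γ b)

      inside? : Decidable Inside
      inside? b = All.all? (c A.≼?_) (ΓB.Γ b)

      ¬E-p-below-w : ∀ {b} → b B.≼ w → ¬ E p b
      ¬E-p-below-w b≼w epb = B.parent⇒⋡ wm (B.≼-trans (minΓ-least epb) b≼w)

      escape⇒E-p : ∀ {a b} → E a b → c A.≼ a → ¬ Inside b → E p b
      escape⇒E-p eab c≼a outside
        with a′ , a′∈ , c⋠a′ ← find (AllP.¬All⇒Any¬ (c A.≼?_) _ outside)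
        with q , qc , eqb , _ ← ΓB.Γ-straddle c≼a eab c⋠a′ (ΓB.∈Γ⇒E a′∈)
        with refl ← A.parent-unique qc pc = eqb

      inside-w : E c w → Inside w
      inside-w ecw =
        decidable-stable (inside? w) (¬E-p-below-w B.≼-refl ∘ escape⇒E-p ecw A.≼-refl)

      outside-root : ¬ Inside rB
      outside-root inside = A.parent⇒⋠root pc (All.lookup inside (ΓB.E⇒∈Γ root-edge))

      root-to-w : WalkFT TB rB w (B.rootPath w)
      root-to-w = proj₁ (B.rootPath-path w)

      no-exit-from-Inside : ¬ Crossing {R = TB} Inside (B.rootPath w)
      no-exit-from-Inside (crossing _ a≼w r inside-b outside-a)
        with h , ehb , eha ← ΓA.edge-common-neighbour (connected-flip E conn) r
        = ¬E-p-below-w a≼w (escape⇒E-p eha (All.lookup inside-b (ΓB.E⇒∈Γ ehb)) outside-a)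

    parent-of-minΓ-not-adjacent-to-child : ¬ E c w
    parent-of-minΓ-not-adjacent-to-child ecw = no-exit-from-Inside
      (walk-crossing-sym B.R-sym inside? root-to-w
        (walk-last∈ root-to-w) (inside-w ecw) (walk-head∈ root-to-w) outside-root)

  minΓ-parent-monotone : ∀ {p c} → A.Parent p c → minΓ p B.≼ minΓ c
  minΓ-parent-monotone {p} {c} pc with v , epv , ecv ← ΓB.parent-common-neighbour conn pc
    with minΓ p B.≼? minΓ c
  ... | yes le = le
  ... | no ¬le
    with w , wm , ecw , _ ← ΓA.Γ-straddle (minΓ-least epv) ecv ¬le minΓ-adjacent =
    ⊥-elim (parent-of-minΓ-not-adjacent-to-child pc wm ecw)

  minΓ-monotone : ∀ {a b} → a A.≼ b → minΓ a B.≼ minΓ b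
  minΓ-monotone =
    Star.fold B._≼_ B.≼-trans B.≼-refl ∘ Star.gmap minΓ minΓ-parent-monotone ∘ A.≼⇒Parent*

module TreeOrders {nH nV : ℕ} (E : Fin nH → Fin nV → Set)
    {TH : Fin nH → Fin nH → Set} {TV : Fin nV → Fin nV → Set}
    (treeH : IsTree TH) (treeV : IsTree TV) (hroot : Fin nH) (vroot : Fin nV) where
  open Orders E TH TV hroot vroot
  private
    module H = RootedTree _≟_ treeH hroot
    module V = RootedTree _≟_ treeV vroot

  ≤-trans : ∀ {x y z} → x ≤ y → y ≤ z → x ≤ z
  ≤-trans {inj₁ _} {inj₁ _} {inj₁ _} x≤y y≤z =
    H.≼⇒TreeLe (H.≼-trans (H.TreeLe⇒≼ x≤y) (H.TreeLe⇒≼ y≤z))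
  ≤-trans {inj₂ _} {inj₂ _} {inj₂ _} x≤y y≤z =
    V.≼⇒TreeLe (V.≼-trans (V.TreeLe⇒≼ x≤y) (V.TreeLe⇒≼ y≤z))

  ≤-antisym : ∀ {x y} → x ≤ y → y ≤ x → x ≡ y
  ≤-antisym {inj₁ _} {inj₁ _} x≤y y≤x = cong inj₁ (H.≼-antisym (H.TreeLe⇒≼ x≤y) (H.TreeLe⇒≼ y≤x))
  ≤-antisym {inj₂ _} {inj₂ _} x≤y y≤x = cong inj₂ (V.≼-antisym (V.TreeLe⇒≼ x≤y) (V.TreeLe⇒≼ y≤x))

  ≤⇒<⊎≡ : ∀ {x y} → x ≤ y → x < y ⊎ x ≡ y
  ≤⇒<⊎≡ {x} {y} x≤y with ≡-dec _≟_ _≟_ x y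
  ... | yes x≡y = inj₂ x≡y
  ... | no  x≢y = inj₁ (x≤y , x≢y)

  <-trans : ∀ {x y z} → x < y → y < z → x < z
  <-trans (x≤y , _) (y≤z , y≢z) = ≤-trans x≤y y≤z , λ { refl → y≢z (≤-antisym y≤z x≤y) }

  IsMinΓ-unique : ∀ {s m m′} → IsMinΓ s m → IsMinΓ s m′ → m ≡ m′
  IsMinΓ-unique (adj , least) (adj′ , least′) = ≤-antisym (least _ adj′) (least′ _ adj)

  _<ₘ_ : Vert nH nV → Vert nH nV → Set
  s₁ <ₘ s₂ = ∃[ m₁ ] ∃[ m₂ ]
    (IsMinΓ s₁ m₁ × IsMinΓ s₂ m₂ × ((m₁ < m₂) ⊎ ((m₁ ≡ m₂) × (s₁ < s₂))))

  <ₘ-irrefl : ∀ {s} → ¬ s <ₘ s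
  <ₘ-irrefl {s} (_ , _ , min₁ , min₂ , inj₁ (_ , m₁≢m₂)) = m₁≢m₂ (IsMinΓ-unique {s} min₁ min₂)
  <ₘ-irrefl     (_ , _ , _    , _    , inj₂ (_ , (_ , s≢s))) = s≢s refl

  <ₘ-trans : ∀ {x y z} → x <ₘ y → y <ₘ z → x <ₘ z
  <ₘ-trans {y = y} (m₁ , m₂ , min₁ , min₂ , o₁) (m₂′ , m₃ , min₂′ , min₃ , o₂)
    with refl ← IsMinΓ-unique {y} min₂ min₂′ = m₁ , m₃ , min₁ , min₃ , lex o₁ o₂
    where
    lex : ∀ {a b c s t u} → (a < b) ⊎ (a ≡ b × s < t) → (b < c) ⊎ (b ≡ c × t < u) →
          (a < c) ⊎ (a ≡ c × s < u)
    lex (inj₁ a<b)          (inj₁ b<c)          = inj₁ (<-trans a<b b<c)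
    lex (inj₁ a<b)          (inj₂ (refl , _))   = inj₁ a<b
    lex (inj₂ (refl , _))   (inj₁ b<c)          = inj₁ b<c
    lex (inj₂ (refl , s<t)) (inj₂ (refl , t<u)) = inj₂ (refl , <-trans s<t t<u)

  <b-isStrictPartialOrder : IsStrictPartialOrder _≡_ _<b_
  <b-isStrictPartialOrder = record
    { isEquivalence = isEquivalence
    ; irrefl        = λ { {inj₁ _} refl → <ₘ-irrefl ; {inj₂ _} refl → <ₘ-irrefl }
    ; trans         = λ { {inj₁ _} {inj₁ _} {inj₁ _} → <ₘ-trans
                        ; {inj₂ _} {inj₂ _} {inj₂ _} → <ₘ-trans }
    ; <-resp-≈      = (λ { refl s<t → s<t }) , (λ { refl s<t → s<t })
    }

  minima-≤⇒<ₘ : ∀ {s₁ s₂ m₁ m₂} → IsMinΓ s₁ m₁ → IsMinΓ s₂ m₂ →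
                m₁ ≤ m₂ → s₁ < s₂ → s₁ <ₘ s₂
  minima-≤⇒<ₘ {m₁ = m₁} {m₂} min₁ min₂ m₁≤m₂ s₁<s₂ with ≤⇒<⊎≡ m₁≤m₂
  ... | inj₁ m₁<m₂ = m₁ , m₂ , min₁ , min₂ , inj₁ m₁<m₂
  ... | inj₂ m₁≡m₂ = m₁ , m₂ , min₁ , min₂ , inj₂ (m₁≡m₂ , s₁<s₂)

module _ {nH nV : ℕ} {E : Fin nH → Fin nV → Set}
    {TH : Fin nH → Fin nH → Set} {TV : Fin nV → Fin nV → Set}
    (G : IsTreePathIntersectionGraph E TH TV)
    (hroot : Fin nH) (vroot : Fin nV) (root-edge : E hroot vroot) where
  open IsTreePathIntersectionGraph G
  open Orders E TH TV hroot vroot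
  open TreeOrders E treeH treeV hroot vroot using (minima-≤⇒<ₘ)
  private
    module H = RootedTree _≟_ treeH hroot
    module V = RootedTree _≟_ treeV vroot
    module MH = MinNeighbour E treeH treeV hroot vroot root-edge nbhdH nbhdV connected
    module MV = MinNeighbour (flip E) treeV treeH vroot hroot root-edge nbhdV nbhdH
                             (connected-flip E connected)

    IsMinΓ-minΓ-H : ∀ h → IsMinΓ (inj₁ h) (inj₂ (MH.minΓ h))
    IsMinΓ-minΓ-H h = MH.minΓ-adjacent , λ { (inj₂ v) ehv → V.≼⇒TreeLe (MH.minΓ-least ehv) }

    IsMinΓ-minΓ-V : ∀ v → IsMinΓ (inj₂ v) (inj₁ (MV.minΓ v))
    IsMinΓ-minΓ-V v = MV.minΓ-adjacent , λ { (inj₁ h) ehv → H.≼⇒TreeLe (MV.minΓ-least ehv) }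

  <⇒<b : ∀ s₁ s₂ → s₁ < s₂ → s₁ <b s₂
  <⇒<b (inj₁ h₁) (inj₁ h₂) h₁<h₂ = minima-≤⇒<ₘ (IsMinΓ-minΓ-H h₁) (IsMinΓ-minΓ-H h₂)
    (V.≼⇒TreeLe (MH.minΓ-monotone (H.TreeLe⇒≼ (proj₁ h₁<h₂)))) h₁<h₂
  <⇒<b (inj₂ v₁) (inj₂ v₂) v₁<v₂ = minima-≤⇒<ₘ (IsMinΓ-minΓ-V v₁) (IsMinΓ-minΓ-V v₂)
    (H.≼⇒TreeLe (MV.minΓ-monotone (V.TreeLe⇒≼ (proj₁ v₁<v₂)))) v₁<v₂

lemma14 : {nH nV : ℕ}
    (E : Fin nH → Fin nV → Set)
    (TH : Fin nH → Fin nH → Set) (TV : Fin nV → Fin nV → Set)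
    → IsTreePathIntersectionGraph E TH TV
    → (hroot : Fin nH) (vroot : Fin nV)
    → E hroot vroot
    → IsLeaf TV vroot
    → IsStrictPartialOrder _≡_ (Orders._<b_ E TH TV hroot vroot)
      × (∀ s₁ s₂ → Orders._<_ E TH TV hroot vroot s₁ s₂
                 → Orders._<b_ E TH TV hroot vroot s₁ s₂)
lemma14 E TH TV G hroot vroot root-edge _ =
  TreeOrders.<b-isStrictPartialOrder E treeH treeV hroot vroot , <⇒<b G hroot vroot root-edge
  where open IsTreePathIntersectionGraph G
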